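{- Let $\mathcal T$ be a planar or toric trinity and $s$ a state of $\mathcal T$. Two distinct clockwise empty black triangles of $s$ never share a vertex, and two distinct counter-clockwise empty black triangles of $s$ never share a vertex.
   Context: A trinity is a triangulation $\mathcal T$ of a compact connected oriented closed surface $\Sigma$ whose vertices are colored red, green, blue so that the endpoints of every edge have different colors (so each triangle has one vertex of each color). A triangle is black if its vertices, read clockwise (with respect to the orientation of $\Sigma$), appear in the cyclic order blue, green, red; otherwise it is white. A toric trinity is a trinity on the torus. A planar trinity is a trinity on $S^2$ together with a chosen white triangle called outer; its three vertices are called roots. A state of a toric trinity is a bijection between the set of white triangles and the set of vertices matching each white triangle with one of its own vertices; for a planar trinity it is such a bijection between non-outer white triangles and non-root vertices. Let $\Delta$ be a black triangle with vertices $u_1,u_2,u_3$ in clockwise order, and let $W_i$ ($i=1,2,3$, indices mod 3) be the white triangle sharing the edge $u_iu_{i+1}$ with $\Delta$. $\Delta$ is a clockwise empty black triangle of the state $s$ if $s$ matches $W_i$ with $u_{i+1}$ for $i=1,2,3$, and a counter-clockwise empty black triangle of $s$ if $s$ matches $W_i$ with $u_i$ for $i=1,2,3$. -}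

module Defs where

open import Data.Nat using (ℕ; _+_)
open import Data.Fin using (Fin)
open import Data.Product using (Σ; ∃; ∃₂; _×_; _,_)
open import Relation.Nullary using (¬_)
open import Relation.Binary.PropositionalEquality using (_≡_; _≢_)
open import Relation.Binary.Construct.Closure.ReflexiveTransitive using (Star)
open import Function.Definitions using (Bijective; Injective)

-- Colours and the clockwise order inside a BLACK triangle.
-- A black triangle read clockwise is  blue, green, red  (cyclically).

data Color : Set where
  red green blue : Color

cw : Color → Color
cw blue  = green
cw green = red
cw red   = blue

ccw : Color → Color
ccw green = blue
ccw red   = green
ccw blue  = red

-- Combinatorial data of a properly 3-coloured triangulation of a closed
-- oriented surface.  Triangles are black (Fin nB) or
-- white (Fin nW); every triangle has exactly one vertex of each colour.
-- Each edge lies in exactly one black and one white triangle;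
-- across c t is the white triangle sharing with the black triangle t
-- the edge of t opposite to t's vertex of colour c.

record Trinity : Set where
  field
    nV nB nW    : ℕ
    col         : Fin nV → Color
    bvert       : Fin nB → Color → Fin nV
    wvert       : Fin nW → Color → Fin nV
    bvert-col   : ∀ t c → col (bvert t c) ≡ c
    wvert-col   : ∀ w c → col (wvert w c) ≡ c
    across      : Color → Fin nB → Fin nW
    across-bij  : ∀ c → Bijective _≡_ _≡_ (across c)
    across-edge : ∀ c t d → d ≢ c → wvert (across c t) d ≡ bvert t d

  -- t' is the next black triangle after t turning around t's vertex of
  -- colour c (they are separated by one white triangle containing that vertex)
  Around : Color → Fin nB → Fin nB → Set
  Around c t t' = across (cw c) t ≡ across (ccw c) t'

  Adjacent : Fin nB → Fin nB → Set
  Adjacent t t' = Σ Color λ c → Around c t t'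

  -- The glued complex is a closed connected surface whose vertex set is
  -- exactly Fin nV: every vertex lies on a triangle, the link of every
  -- vertex is a single cycle, and the triangulation is connected.
  record IsSurface : Set where
    field
      vertex-used : ∀ v → ∃ λ t → bvert t (col v) ≡ v
      vertex-link : ∀ c t t' → bvert t c ≡ bvert t' c → Star (Around c) t t'
      connected   : ∀ t t' → Star Adjacent t t'

  -- Euler characteristic: V - E + F = nV - 3 nB + 2 nB = nV - nB.
  -- Torus: χ = 0.  Sphere: χ = 2.
  IsToric : Set
  IsToric = IsSurface × nV ≡ nB

  IsPlanar : Set
  IsPlanar = IsSurface × nV ≡ nB + 2

  ShareVertex : Fin nB → Fin nB → Set
  ShareVertex t t' = ∃₂ λ c c' → bvert t c ≡ bvert t' c'

  -- Given the relation "the state matches white triangle w with vertex v":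
  -- Δ = t with u_i, u_{i+1}, u_{i+2} clockwise; W_i is across the edge
  -- u_i u_{i+1}, i.e. opposite to u_{i+2}.
  -- clockwise empty: W_i matched with u_{i+1} (colour c, so u_{i+2} has colour cw c)
  CWEmpty : (Fin nW → Fin nV → Set) → Fin nB → Set
  CWEmpty M t = ∀ c → M (across (cw c) t) (bvert t c)

  -- counter-clockwise empty: W_i matched with u_i (colour c, u_{i+2} has colour ccw c)
  CCWEmpty : (Fin nW → Fin nV → Set) → Fin nB → Set
  CCWEmpty M t = ∀ c → M (across (ccw c) t) (bvert t c)

  NoSharedEmpty : (Fin nW → Fin nV → Set) → Set
  NoSharedEmpty M = ∀ t t' → t ≢ t' →
      (CWEmpty M t → CWEmpty M t' → ¬ ShareVertex t t')
    × (CCWEmpty M t → CCWEmpty M t' → ¬ ShareVertex t t')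

open Trinity public

record ToricState (T : Trinity) : Set where
  field
    s        : Fin (nW T) → Fin (nV T)
    s-vertex : ∀ w → ∃ λ c → wvert T w c ≡ s w
    s-bij    : Bijective _≡_ _≡_ s

toricMatches : (T : Trinity) → ToricState T → Fin (nW T) → Fin (nV T) → Set
toricMatches T S w v = ToricState.s S w ≡ v

-- planar with outer white triangle o: bijection between non-outer white
-- triangles and non-root vertices (roots = vertices of o).  It is encoded
-- as a total function whose value on o is irrelevant.
record PlanarState (T : Trinity) (o : Fin (nW T)) : Set where
  field
    s         : Fin (nW T) → Fin (nV T)
    s-vertex  : ∀ w → w ≢ o → ∃ λ c → wvert T w c ≡ s w
    s-nonroot : ∀ w → w ≢ o → ∀ c → s w ≢ wvert T o c
    s-inj     : ∀ w w' → w ≢ o → w' ≢ o → s w ≡ s w' → w ≡ w'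
    s-surj    : ∀ v → (∀ c → v ≢ wvert T o c) → ∃ λ w → w ≢ o × s w ≡ v

planarMatches : (T : Trinity) (o : Fin (nW T)) → PlanarState T o →
                Fin (nW T) → Fin (nV T) → Set
planarMatches T o S w v = w ≢ o × PlanarState.s S w ≡ v

module Submission where

-- In a black triangle t every vertex is determined by its
-- colour, and two triangles can only share a vertex in the same colour
-- slot (colours are a property of vertices).  A clockwise (resp.
-- counter-clockwise) empty black triangle t matches its vertex of colour c
-- with the white triangle  across (f c) t,  where f = cw (resp. ccw).  If
-- t and t' are both empty for the same f and share the vertex v of colour
-- c, then v is matched with  across (f c) t  and with  across (f c) t'.
-- A state matches every vertex with at most one white triangle, so these
-- white triangles coincide, and since  across (f c)  is injective, t = t'.

open import Defs
open import Data.Fin using (Fin)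
open import Data.Product using (_×_; _,_; proj₁; proj₂)
open import Relation.Binary.PropositionalEquality

module _ (T : Trinity) where

  -- A relation between white triangles and vertices that matches each
  -- vertex with at most one white triangle (the relevant half of a state).
  VertexInjective : (Fin (nW T) → Fin (nV T) → Set) → Set
  VertexInjective M = ∀ {w w' v} → M w v → M w' v → w ≡ w'

  -- For f = cw this is CWEmpty, for f = ccw it is CCWEmpty.
  EmptyFor : (Color → Color) → (Fin (nW T) → Fin (nV T) → Set) → Fin (nB T) → Set
  EmptyFor f M t = ∀ c → M (across T (f c) t) (bvert T t c)

  shared-slot-colour : ∀ t t' c c' → bvert T t c ≡ bvert T t' c' → c ≡ c'
  shared-slot-colour t t' c c' e = begin
    c                     ≡⟨ sym (bvert-col T t c) ⟩
    col T (bvert T t c)   ≡⟨ cong (col T) e ⟩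
    col T (bvert T t' c') ≡⟨ bvert-col T t' c' ⟩
    c'                    ∎
    where open ≡-Reasoning

  empty-sharing⇒equal : (f : Color → Color) (M : Fin (nW T) → Fin (nV T) → Set) →
    VertexInjective M → ∀ t t' → EmptyFor f M t → EmptyFor f M t' →
    ShareVertex T t t' → t ≡ t'
  empty-sharing⇒equal f M inj t t' empty empty' (c , c' , e)
    with shared-slot-colour t t' c c' e
  ... | refl = proj₁ (across-bij T (f c)) same-white
    where
    same-white : across T (f c) t ≡ across T (f c) t'
    same-white = inj (empty c) (subst (M (across T (f c) t')) (sym e) (empty' c))

  noSharedEmpty : (M : Fin (nW T) → Fin (nV T) → Set) → VertexInjective M →
    NoSharedEmpty T M
  noSharedEmpty M inj t t' t≢t' =
      (λ cw-t cw-t' share → t≢t' (empty-sharing⇒equal cw M inj t t' cw-t cw-t' share))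
    , (λ ccw-t ccw-t' share → t≢t' (empty-sharing⇒equal ccw M inj t t' ccw-t ccw-t' share))

toric-vertexInjective : (T : Trinity) (S : ToricState T) →
  VertexInjective T (toricMatches T S)
toric-vertexInjective T S e e' = proj₁ (ToricState.s-bij S) (trans e (sym e'))

planar-vertexInjective : (T : Trinity) (o : Fin (nW T)) (S : PlanarState T o) →
  VertexInjective T (planarMatches T o S)
planar-vertexInjective T o S {w} {w'} (w≢o , e) (w'≢o , e') =
  PlanarState.s-inj S w w' w≢o w'≢o (trans e (sym e'))

lemma2p5 : ((T : Trinity) → IsToric T → (S : ToricState T) →
    NoSharedEmpty T (toricMatches T S))
    × ((T : Trinity) → (o : Fin (nW T)) → IsPlanar T → (S : PlanarState T o) →
    NoSharedEmpty T (planarMatches T o S))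
lemma2p5 =
    (λ T _ S → noSharedEmpty T (toricMatches T S) (toric-vertexInjective T S))
  , (λ T o _ S → noSharedEmpty T (planarMatches T o S) (planar-vertexInjective T o S))
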